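{- Let $\mathcal{T}_0$ be a first-order theory with signature $\Pi_0=(\Sigma_0,\mathsf{Pred})$. Let $\Sigma_1,\Sigma_2$ be two disjoint sets of (new) function symbols, $\Pi_i=(\Sigma_0\cup\Sigma_i,\mathsf{Pred})$ for $i=1,2$, and $\Pi=(\Sigma_0\cup\Sigma_1\cup\Sigma_2,\mathsf{Pred})$. Let $\mathcal{K}_2$ be a set of $\Sigma_2$-flat clauses over $\Pi_2$ such that in each clause $C\in\mathcal{K}_2$ all variables of $C$ occur below some function symbol in $\Sigma_2$. Let $P$ be a partial $\Pi$-structure such that its $\Pi_0$-reduct is a total model of $\mathcal{T}_0$ and $P$ weakly satisfies $\mathcal{K}_2$. Let $A$ be a total $\Pi_1$-structure and $h:P\to A$ a weak $\Pi_1$-embedding. Then a partial $\Sigma_2$-structure can be defined on $A$ such that $A$ weakly satisfies $\mathcal{K}_2$ and $h$ is a weak $\Pi$-embedding.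
   Context: A partial structure over a signature is a nonempty set with partial functions for the function symbols and relations for the predicate symbols; it is total if all functions are total. Terms evaluate under an assignment as usual, and are undefined if some subterm is undefined or a function is applied outside its domain. Weak satisfaction: a literal ($s\approx t$, $s\not\approx t$, $Q(\bar t)$, $\neg Q(\bar t)$) holds weakly under an assignment if all involved terms are defined and the literal is true, or if at least one involved term is undefined; a clause holds weakly under an assignment if some literal does, and in the structure if this holds for all assignments. A weak embedding (w.r.t. a signature) $i:A\to B$ is an injective total map such that whenever $f_A(\bar a)$ is defined for a function symbol $f$ of that signature, $f_B(i(\bar a))$ is defined and equals $i(f_A(\bar a))$, and $Q_A(\bar a)$ iff $Q_B(i(\bar a))$ for each predicate symbol $Q$. A non-ground clause is $\Sigma_2$-flat if no function symbol (including constants) occurs as an argument of a function symbol in $\Sigma_2$. -}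

module Defs where

open import Level using (0ℓ)
open import Data.Nat using (ℕ)
open import Data.Fin using (Fin)
open import Data.Vec using (Vec; lookup; map)
open import Data.List using (List; tabulate) renaming (_∷_ to _∷ₗ_; [] to []ₗ)
open import Data.List.Relation.Unary.Any using (Any)
open import Data.List.Relation.Unary.All using (All)
open import Data.Sum using (_⊎_; inj₁; inj₂; [_,_])
open import Data.Product using (Σ; ∃; _×_; _,_)
open import Data.Empty using (⊥)
open import Data.Unit using (⊤)
open import Relation.Nullary using (¬_)
open import Relation.Binary.PropositionalEquality using (_≡_; _≢_)
open import Function using (_∘_)

data Term {F : Set} (ar : F → ℕ) : Set where
  var : ℕ → Term ar
  app : (f : F) → (Fin (ar f) → Term ar) → Term ar

data Formula {F Pr : Set} (ar : F → ℕ) (par : Pr → ℕ) : Set where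
  _≐_   : Term ar → Term ar → Formula ar par
  atom  : (Q : Pr) → (Fin (par Q) → Term ar) → Formula ar par
  ⊥ᶠ    : Formula ar par
  ¬ᶠ_   : Formula ar par → Formula ar par
  _∧ᶠ_  : Formula ar par → Formula ar par → Formula ar par
  _∨ᶠ_  : Formula ar par → Formula ar par → Formula ar par
  _⇒ᶠ_  : Formula ar par → Formula ar par → Formula ar par
  ∀ᶠ    : ℕ → Formula ar par → Formula ar par
  ∃ᶠ    : ℕ → Formula ar par → Formula ar par

data Literal {F Pr : Set} (ar : F → ℕ) (par : Pr → ℕ) : Set where
  _≈ₗ_ : Term ar → Term ar → Literal ar par
  _≉ₗ_ : Term ar → Term ar → Literal ar par
  posₗ : (Q : Pr) → (Fin (par Q) → Term ar) → Literal ar par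
  negₗ : (Q : Pr) → (Fin (par Q) → Term ar) → Literal ar par

Clause : {F Pr : Set} (ar : F → ℕ) (par : Pr → ℕ) → Set
Clause ar par = List (Literal ar par)

-- Semantics.  Partial functions are functional relations (graphs).

record PFuns (A : Set) {F : Set} (ar : F → ℕ) : Set₁ where
  field
    graph      : (f : F) → Vec A (ar f) → A → Set
    functional : ∀ {f as x y} → graph f as x → graph f as y → x ≡ y
open PFuns public

Rels : (A : Set) {Pr : Set} (par : Pr → ℕ) → Set₁
Rels A {Pr} par = (Q : Pr) → Vec A (par Q) → Set

Total : {A F : Set} {ar : F → ℕ} → PFuns A ar → Set
Total {A} {F} {ar} I = (f : F) (as : Vec A (ar f)) → ∃ λ x → graph I f as x

restrict : {A F G : Set} {ar : F → ℕ} → PFuns A ar → (g : G → F) → PFuns A (ar ∘ g)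
graph (restrict I g) f = graph I (g f)
functional (restrict I g) = functional I

-- the Π₂-reduct of a Π-structure (symbols (Σ₀ ⊎ Σ₁) ⊎ Σ₂ ↦ Σ₀ ⊎ Σ₂)
red₂ : {A F0 F1 F2 : Set} {ar0 : F0 → ℕ} {ar1 : F1 → ℕ} {ar2 : F2 → ℕ} →
       PFuns A [ [ ar0 , ar1 ] , ar2 ] → PFuns A [ ar0 , ar2 ]
graph (red₂ I) (inj₁ f) = graph I (inj₁ (inj₁ f))
graph (red₂ I) (inj₂ f) = graph I (inj₂ f)
functional (red₂ I) {inj₁ f} = functional I
functional (red₂ I) {inj₂ f} = functional I

_⊕_ : {A F1 F2 : Set} {ar1 : F1 → ℕ} {ar2 : F2 → ℕ} →
      PFuns A ar1 → PFuns A ar2 → PFuns A [ ar1 , ar2 ]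
graph (I ⊕ J) (inj₁ f) = graph I f
graph (I ⊕ J) (inj₂ f) = graph J f
functional (I ⊕ J) {inj₁ f} = functional I
functional (I ⊕ J) {inj₂ f} = functional J

module _ {A F Pr : Set} {ar : F → ℕ} {par : Pr → ℕ}
         (I : PFuns A ar) (R : Rels A par) where

  -- term evaluation (relational; undefined = no value)
  Eval : (ℕ → A) → Term ar → A → Set
  Eval β (var x)    a = β x ≡ a
  Eval β (app f ts) a =
    Σ (Vec A (ar f)) λ as → ((k : Fin (ar f)) → Eval β (ts k) (lookup as k)) × graph I f as a

  Defined : (ℕ → A) → Term ar → Set
  Defined β t = ∃ λ a → Eval β t a

  EvalArgs : (ℕ → A) → {n : ℕ} → (Fin n → Term ar) → Vec A n → Set
  EvalArgs β {n} ts as = (k : Fin n) → Eval β (ts k) (lookup as k)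

  update : (ℕ → A) → ℕ → A → (ℕ → A)
  update β x a y with Data.Nat._≟_ x y
  ... | Relation.Nullary.yes _ = a
  ... | Relation.Nullary.no _  = β y

  Sat : (ℕ → A) → Formula ar par → Set
  Sat β (s ≐ t)     = Σ A λ a → Σ A λ b → Eval β s a × Eval β t b × a ≡ b
  Sat β (atom Q ts) = Σ (Vec A (par Q)) λ as → EvalArgs β ts as × R Q as
  Sat β ⊥ᶠ          = ⊥
  Sat β (¬ᶠ φ)      = ¬ Sat β φ
  Sat β (φ ∧ᶠ ψ)    = Sat β φ × Sat β ψ
  Sat β (φ ∨ᶠ ψ)    = Sat β φ ⊎ Sat β ψ
  Sat β (φ ⇒ᶠ ψ)    = Sat β φ → Sat β ψ
  Sat β (∀ᶠ x φ)    = (a : A) → Sat (update β x a) φ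
  Sat β (∃ᶠ x φ)    = Σ A λ a → Sat (update β x a) φ

  -- model of a theory (a set of formulas, read universally closed)
  Model : (Formula ar par → Set) → Set
  Model T = (φ : Formula ar par) → T φ → (β : ℕ → A) → Sat β φ

  WeakLit : (ℕ → A) → Literal ar par → Set
  WeakLit β (s ≈ₗ t) =
    (Σ A λ a → Σ A λ b → Eval β s a × Eval β t b × a ≡ b)
    ⊎ (¬ Defined β s ⊎ ¬ Defined β t)
  WeakLit β (s ≉ₗ t) =
    (Σ A λ a → Σ A λ b → Eval β s a × Eval β t b × a ≢ b)
    ⊎ (¬ Defined β s ⊎ ¬ Defined β t)
  WeakLit β (posₗ Q ts) =
    (Σ (Vec A (par Q)) λ as → EvalArgs β ts as × R Q as)
    ⊎ (Σ (Fin (par Q)) λ k → ¬ Defined β (ts k))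
  WeakLit β (negₗ Q ts) =
    (Σ (Vec A (par Q)) λ as → EvalArgs β ts as × ¬ R Q as)
    ⊎ (Σ (Fin (par Q)) λ k → ¬ Defined β (ts k))

  WeakClause : (ℕ → A) → Clause ar par → Set
  WeakClause β C = Any (WeakLit β) C

  WeakSat : (Clause ar par → Set) → Set
  WeakSat K = (C : Clause ar par) → K C → (β : ℕ → A) → WeakClause β C

WeakEmb : {A B F Pr : Set} {ar : F → ℕ} {par : Pr → ℕ} →
          PFuns A ar → Rels A par → PFuns B ar → Rels B par → (A → B) → Set
WeakEmb {A} {B} {F} {Pr} {ar} {par} IA RA IB RB i =
  (∀ {x y} → i x ≡ i y → x ≡ y)
  × ((f : F) (as : Vec A (ar f)) (a : A) → graph IA f as a → graph IB f (map i as) (i a))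
  × ((Q : Pr) (as : Vec A (par Q)) → (RA Q as → RB Q (map i as)) × (RB Q (map i as) → RA Q as))

litTerms : {F Pr : Set} {ar : F → ℕ} {par : Pr → ℕ} → Literal ar par → List (Term ar)
litTerms (s ≈ₗ t)    = s ∷ₗ t ∷ₗ []ₗ
litTerms (s ≉ₗ t)    = s ∷ₗ t ∷ₗ []ₗ
litTerms (posₗ Q ts) = tabulate ts
litTerms (negₗ Q ts) = tabulate ts

Occurs : {F : Set} {ar : F → ℕ} → ℕ → Term ar → Set
Occurs x (var y)    = x ≡ y
Occurs x (app f ts) = Σ _ λ k → Occurs x (ts k)

IsVar : {F : Set} {ar : F → ℕ} → Term ar → Set
IsVar (var _)   = ⊤
IsVar (app _ _) = ⊥

module _ {F0 F2 Pr : Set} {ar0 : F0 → ℕ} {ar2 : F2 → ℕ} {par : Pr → ℕ} where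

  private
    T = Term [ ar0 , ar2 ]

  Below₂ : ℕ → T → Set
  Below₂ x (var y)           = ⊥
  Below₂ x (app (inj₁ f) ts) = Σ _ λ k → Below₂ x (ts k)
  Below₂ x (app (inj₂ f) ts) = Σ _ λ k → Occurs x (ts k)

  FlatTerm₂ : T → Set
  FlatTerm₂ (var y)           = ⊤
  FlatTerm₂ (app (inj₁ f) ts) = (k : _) → FlatTerm₂ (ts k)
  FlatTerm₂ (app (inj₂ f) ts) = (k : _) → IsVar (ts k)

  OccursC : ℕ → Clause [ ar0 , ar2 ] par → Set
  OccursC x C = Any (λ l → Any (Occurs x) (litTerms l)) C

  BelowC : ℕ → Clause [ ar0 , ar2 ] par → Set
  BelowC x C = Any (λ l → Any (Below₂ x) (litTerms l)) C

  Σ₂-Flat : Clause [ ar0 , ar2 ] par → Set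
  Σ₂-Flat C = (∃ λ x → OccursC x C) × All (λ l → All FlatTerm₂ (litTerms l)) C

  VarsBelow₂ : Clause [ ar0 , ar2 ] par → Set
  VarsBelow₂ C = (x : ℕ) → OccursC x C → BelowC x C

module Submission where

-- The Σ₂-functions of A are the push-forward of those of P along h: f(b̄) = b
-- holds in A iff b̄ = h(ā), b = h(a) and f(ā) = a in P.  This is functional
-- because h is injective, and it makes h a weak Π-embedding by construction.
-- For a clause C of K₂ and an assignment β into A there are two cases.
--   * Some variable x of C has β(x) outside the image of h.  Since x occurs
--     directly below a Σ₂-symbol in some term of a flat literal, and the
--     push-forward is only defined on the image of h, that term is undefined,
--     so the literal (hence C) holds weakly.
--   * All variables of C are mapped into the image of h.  Pull β back to an
--     assignment α into P.  Since h is a weak embedding, P is total on Σ₀ and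
--     A has no Σ₂-values beyond those coming from P, a term is defined in A
--     under β iff it is defined in P under α, with values related by h; so the
--     weak validity of C in P under α transfers to A under β.

open import Defs
open import Level using (0ℓ)
open import Axiom.ExcludedMiddle using (ExcludedMiddle)
open import Data.Nat using (ℕ)
open import Data.Sum using (inj₁; inj₂; [_,_])
open import Data.Product using (Σ; _×_; _,_; proj₁; proj₂)
open import Function using (_∘_)
open import Data.Fin using (Fin; zero; suc)
open import Data.Vec using (Vec; lookup; map; []; _∷_)
open import Data.Vec.Properties using (lookup-map; ∷-injective)
open import Data.List using (List; tabulate) renaming (_∷_ to _∷ₗ_)
open import Data.List.Relation.Unary.Any as Any using (Any; here; there)
open import Data.List.Relation.Unary.All using (All; _∷_)
open import Data.List.Relation.Unary.Any.Properties using (tabulate⁺; tabulate⁻)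
open import Data.Empty using (⊥-elim)
open import Relation.Nullary using (¬_; yes; no)
open import Relation.Nullary.Decidable using (decidable-stable)
open import Relation.Binary.PropositionalEquality using (_≡_; refl; sym; cong; cong₂; subst)

InImage : {P A : Set} → (P → A) → A → Set
InImage {P} h a = Σ P λ p → h p ≡ a

all-any : {X : Set} {P Q : X → Set} {xs : List X} →
          All P xs → Any Q xs → Any (λ x → P x × Q x) xs
all-any (p ∷ _)  (here q)  = here (p , q)
all-any (_ ∷ ps) (there i) = there (all-any ps i)

module _ {P A : Set} (h : P → A) where

  map-injective : (∀ {x y} → h x ≡ h y → x ≡ y) →
                  {n : ℕ} (xs ys : Vec P n) → map h xs ≡ map h ys → xs ≡ ys
  map-injective inj []       []       _ = refl
  map-injective inj (x ∷ xs) (y ∷ ys) e =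
    cong₂ _∷_ (inj (proj₁ (∷-injective e))) (map-injective inj xs ys (proj₂ (∷-injective e)))

  along-map : {n : ℕ} {Q : Fin n → A → Set} (as : Vec P n) →
              ((k : Fin n) → Q k (h (lookup as k))) → (k : Fin n) → Q k (lookup (map h as) k)
  along-map {Q = Q} as q k = subst (Q k) (sym (lookup-map k h as)) (q k)

  collect : {n : ℕ} {Q : Fin n → P → Set} {bs : Vec A n} →
            ((k : Fin n) → Σ P λ p → Q k p × h p ≡ lookup bs k) →
            Σ (Vec P n) λ ps → ((k : Fin n) → Q k (lookup ps k)) × map h ps ≡ bs
  collect {bs = []}     c = [] , (λ ()) , refl
  collect {bs = b ∷ bs} c with c zero | collect {bs = bs} (c ∘ suc)
  ... | p , q , e | ps , qs , es = p ∷ ps , (λ { zero → q ; (suc k) → qs k }) , cong₂ _∷_ e es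

  pullback-assignment : ExcludedMiddle 0ℓ → P → (β : ℕ → A) →
                        Σ (ℕ → P) λ α → (x : ℕ) → InImage h (β x) → h (α x) ≡ β x
  pullback-assignment em p₀ β = α , correct
    where
      α : ℕ → P
      α x with em {InImage h (β x)}
      ... | yes (p , _) = p
      ... | no _        = p₀
      correct : (x : ℕ) → InImage h (β x) → h (α x) ≡ β x
      correct x im with em {InImage h (β x)}
      ... | yes (_ , e) = e
      ... | no ni       = ⊥-elim (ni im)

ReflectsApplications : {P B F : Set} {ar : F → ℕ} → PFuns P ar → PFuns B ar → (P → B) → Set
ReflectsApplications {P} {B} {F} {ar} IP IB h =
  (f : F) (ps : Vec P (ar f)) (b : B) → graph IB f (map h ps) b →
  Σ P λ p → graph IP f ps p × h p ≡ b

module Transfer {P B F Pr : Set} {ar : F → ℕ} {par : Pr → ℕ}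
                (IP : PFuns P ar) (RP : Rels P par) (IB : PFuns B ar) (RB : Rels B par)
                (h : P → B) (emb : WeakEmb IP RP IB RB h) (reflects : ReflectsApplications IP IB h)
                (α : ℕ → P) (β : ℕ → B) where

  private
    injective : ∀ {x y} → h x ≡ h y → x ≡ y
    injective = proj₁ emb
    preserves-graph : (f : F) (as : Vec P (ar f)) (a : P) →
                      graph IP f as a → graph IB f (map h as) (h a)
    preserves-graph = proj₁ (proj₂ emb)
    preserves-rel : (Q : Pr) (as : Vec P (par Q)) → RP Q as → RB Q (map h as)
    preserves-rel Q as = proj₁ (proj₂ (proj₂ emb) Q as)
    reflects-rel : (Q : Pr) (as : Vec P (par Q)) → RB Q (map h as) → RP Q as
    reflects-rel Q as = proj₂ (proj₂ (proj₂ emb) Q as)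

  Agree : Term ar → Set
  Agree t = (x : ℕ) → Occurs x t → h (α x) ≡ β x

  AgreeOn : List (Term ar) → Set
  AgreeOn ts = (x : ℕ) → Any (Occurs x) ts → h (α x) ≡ β x

  agree-head : ∀ {t ts} → AgreeOn (t ∷ₗ ts) → Agree t
  agree-head ag x o = ag x (here o)

  agree-tail : ∀ {t ts} → AgreeOn (t ∷ₗ ts) → AgreeOn ts
  agree-tail ag x o = ag x (there o)

  agree-tabulate : {n : ℕ} {ts : Fin n → Term ar} → AgreeOn (tabulate ts) →
                   (k : Fin n) → Agree (ts k)
  agree-tabulate ag k x o = ag x (tabulate⁺ k o)

  eval-preserved : (t : Term ar) → Agree t → {p : P} → Eval IP RP α t p → Eval IB RB β t (h p)
  eval-preserved (var y)    ag refl           = sym (ag y refl)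
  eval-preserved (app f ts) ag (as , ev , gr) =
    map h as
    , along-map h {Q = λ k → Eval IB RB β (ts k)} as
        (λ k → eval-preserved (ts k) (λ x o → ag x (k , o)) (ev k))
    , preserves-graph f as _ gr

  eval-reflected : (t : Term ar) → Agree t → {b : B} → Eval IB RB β t b →
                   Σ P λ p → Eval IP RP α t p × h p ≡ b
  eval-reflected (var y) ag refl = α y , refl , ag y refl
  eval-reflected (app f ts) ag {b} (bs , ev , gr)
    with collect h {Q = λ k → Eval IP RP α (ts k)} {bs = bs}
                   (λ k → eval-reflected (ts k) (λ x o → ag x (k , o)) (ev k))
  ... | ps , evs , refl with reflects f ps b gr
  ... | p , gp , e = p , (ps , evs , gp) , e

  undefined-reflected : (t : Term ar) → Agree t → ¬ Defined IP RP α t → ¬ Defined IB RB β t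
  undefined-reflected t ag nd (b , ev) with eval-reflected t ag ev
  ... | p , evP , _ = nd (p , evP)

  args-preserved : {n : ℕ} (ts : Fin n → Term ar) → AgreeOn (tabulate ts) → {as : Vec P n} →
                   EvalArgs IP RP α ts as → EvalArgs IB RB β ts (map h as)
  args-preserved ts ag {as} ev =
    along-map h {Q = λ k → Eval IB RB β (ts k)} as
      (λ k → eval-preserved (ts k) (agree-tabulate ag k) (ev k))

  weakLit-transfer : (l : Literal ar par) → AgreeOn (litTerms l) →
                     WeakLit IP RP α l → WeakLit IB RB β l
  weakLit-transfer (s ≈ₗ t) ag (inj₁ (a , b , ea , eb , e)) =
    inj₁ (h a , h b , eval-preserved s (agree-head ag) ea
                    , eval-preserved t (agree-head (agree-tail ag)) eb , cong h e)
  weakLit-transfer (s ≈ₗ t) ag (inj₂ (inj₁ nd)) =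
    inj₂ (inj₁ (undefined-reflected s (agree-head ag) nd))
  weakLit-transfer (s ≈ₗ t) ag (inj₂ (inj₂ nd)) =
    inj₂ (inj₂ (undefined-reflected t (agree-head (agree-tail ag)) nd))
  weakLit-transfer (s ≉ₗ t) ag (inj₁ (a , b , ea , eb , e)) =
    inj₁ (h a , h b , eval-preserved s (agree-head ag) ea
                    , eval-preserved t (agree-head (agree-tail ag)) eb , λ q → e (injective q))
  weakLit-transfer (s ≉ₗ t) ag (inj₂ (inj₁ nd)) =
    inj₂ (inj₁ (undefined-reflected s (agree-head ag) nd))
  weakLit-transfer (s ≉ₗ t) ag (inj₂ (inj₂ nd)) =
    inj₂ (inj₂ (undefined-reflected t (agree-head (agree-tail ag)) nd))
  weakLit-transfer (posₗ Q ts) ag (inj₁ (as , ev , r)) =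
    inj₁ (map h as , args-preserved ts ag {as} ev , preserves-rel Q as r)
  weakLit-transfer (posₗ Q ts) ag (inj₂ (k , nd)) =
    inj₂ (k , undefined-reflected (ts k) (agree-tabulate ag k) nd)
  weakLit-transfer (negₗ Q ts) ag (inj₁ (as , ev , r)) =
    inj₁ (map h as , args-preserved ts ag {as} ev , λ r′ → r (reflects-rel Q as r′))
  weakLit-transfer (negₗ Q ts) ag (inj₂ (k , nd)) =
    inj₂ (k , undefined-reflected (ts k) (agree-tabulate ag k) nd)

  weakClause-transfer : (C : Clause ar par) →
                        ((x : ℕ) → Any (λ l → Any (Occurs x) (litTerms l)) C →
                         h (α x) ≡ β x) →
                        WeakClause IP RP α C → WeakClause IB RB β C
  weakClause-transfer (l ∷ₗ C) ag (here w)  =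
    here (weakLit-transfer l (λ x o → ag x (here o)) w)
  weakClause-transfer (l ∷ₗ C) ag (there w) =
    there (weakClause-transfer C (λ x o → ag x (there o)) w)

weakLit-of-undefined : {A F Pr : Set} {ar : F → ℕ} {par : Pr → ℕ}
                       (I : PFuns A ar) (R : Rels A par) (β : ℕ → A) (l : Literal ar par) →
                       Any (λ t → ¬ Defined I R β t) (litTerms l) → WeakLit I R β l
weakLit-of-undefined I R β (s ≈ₗ t)    (here nd)         = inj₂ (inj₁ nd)
weakLit-of-undefined I R β (s ≈ₗ t)    (there (here nd)) = inj₂ (inj₂ nd)
weakLit-of-undefined I R β (s ≉ₗ t)    (here nd)         = inj₂ (inj₁ nd)
weakLit-of-undefined I R β (s ≉ₗ t)    (there (here nd)) = inj₂ (inj₂ nd)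
weakLit-of-undefined I R β (posₗ Q ts) nd                = inj₂ (tabulate⁻ nd)
weakLit-of-undefined I R β (negₗ Q ts) nd                = inj₂ (tabulate⁻ nd)

Σ₂-DomainInImage : {P A F0 F2 : Set} {ar0 : F0 → ℕ} {ar2 : F2 → ℕ} →
                   PFuns A [ ar0 , ar2 ] → (P → A) → Set
Σ₂-DomainInImage {P} {A} {F0} {F2} {ar0} {ar2} IB h =
  (f : F2) (bs : Vec A (ar2 f)) (b : A) → graph IB (inj₂ f) bs b →
  Σ (Vec P (ar2 f)) λ as → map h as ≡ bs

module OutsideImage {P A F0 F2 Pr : Set} {ar0 : F0 → ℕ} {ar2 : F2 → ℕ} {par : Pr → ℕ}
                    (IB : PFuns A [ ar0 , ar2 ]) (RB : Rels A par) (h : P → A)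
                    (domain : Σ₂-DomainInImage IB h)
                    (β : ℕ → A) {x : ℕ} (outside : ¬ InImage h (β x)) where

  variable-outside : (s : Term [ ar0 , ar2 ]) → IsVar s → Occurs x s → {a : P} →
                     ¬ Eval IB RB β s (h a)
  variable-outside (var _) _ refl {a} e = outside (a , sym e)

  undefined-below : (t : Term [ ar0 , ar2 ]) → FlatTerm₂ {par = par} t →
                    Below₂ {par = par} x t → ¬ Defined IB RB β t
  undefined-below (app (inj₁ f) ts) flat (k , below) (_ , bs , ev , _) =
    undefined-below (ts k) (flat k) below (lookup bs k , ev k)
  undefined-below (app (inj₂ f) ts) flat (k , occ) (b , bs , ev , gr) with domain f bs b gr
  ... | as , refl =
    variable-outside (ts k) (flat k) occ
      (subst (Eval IB RB β (ts k)) (lookup-map k h as) (ev k))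

  weakClause-outside : (C : Clause [ ar0 , ar2 ] par) →
                       All (λ l → All (FlatTerm₂ {par = par}) (litTerms l)) C → BelowC x C →
                       WeakClause IB RB β C
  weakClause-outside C flat below = Any.map weakLit (all-any flat below)
    where
      weakLit : ∀ {l} → All (FlatTerm₂ {par = par}) (litTerms l) ×
                        Any (Below₂ {par = par} x) (litTerms l) →
                WeakLit IB RB β l
      weakLit {l} (flatₗ , belowₗ) =
        weakLit-of-undefined IB RB β l
          (Any.map (λ {t} p → undefined-below t (proj₁ p) (proj₂ p)) (all-any flatₗ belowₗ))

module Pushforward {P A F : Set} {ar : F → ℕ} (h : P → A)
                   (injective : ∀ {x y} → h x ≡ h y → x ≡ y) where

  push : PFuns P ar → PFuns A ar
  graph (push I) f bs b =
    Σ (Vec P (ar f)) λ as → map h as ≡ bs × Σ P λ a → graph I f as a × h a ≡ b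
  functional (push I) (as , refl , a , g , refl) (as′ , e , a′ , g′ , refl)
    with map-injective h injective as as′ (sym e)
  ... | refl = cong h (functional I g g′)

  push-extends : (I : PFuns P ar) (f : F) (as : Vec P (ar f)) (a : P) →
                 graph I f as a → graph (push I) f (map h as) (h a)
  push-extends I f as a g = as , refl , a , g , refl

  push-reflects : (I : PFuns P ar) → ReflectsApplications I (push I) h
  push-reflects I f ps b (as , e , a , g , e′) with map-injective h injective as ps e
  ... | refl = a , g , e′

red₂-embedding : {P A F0 F1 F2 Pr : Set}
                 {ar0 : F0 → ℕ} {ar1 : F1 → ℕ} {ar2 : F2 → ℕ} {par : Pr → ℕ}
                 {IP : PFuns P [ [ ar0 , ar1 ] , ar2 ]} {RP : Rels P par}
                 {IA : PFuns A [ [ ar0 , ar1 ] , ar2 ]} {RA : Rels A par} {h : P → A} →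
                 WeakEmb IP RP IA RA h → WeakEmb (red₂ IP) RP (red₂ IA) RA h
red₂-embedding {IP = IP} {IA = IA} {h = h} (injective , preserves , relations) =
  injective , preserves₂ , relations
  where
    preserves₂ : ∀ f as a → graph (red₂ IP) f as a → graph (red₂ IA) f (map h as) (h a)
    preserves₂ (inj₁ f) = preserves (inj₁ (inj₁ f))
    preserves₂ (inj₂ f) = preserves (inj₂ f)

module Extension {P A F0 F1 F2 Pr : Set}
                 {ar0 : F0 → ℕ} {ar1 : F1 → ℕ} {ar2 : F2 → ℕ} {par : Pr → ℕ}
                 (IP : PFuns P [ [ ar0 , ar1 ] , ar2 ]) (RP : Rels P par)
                 (IA : PFuns A [ ar0 , ar1 ]) (RA : Rels A par)
                 (h : P → A) (emb : WeakEmb (restrict IP inj₁) RP IA RA h) where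

  open Pushforward {ar = ar2} h (proj₁ emb)

  J : PFuns A ar2
  J = push (restrict IP inj₂)

  extended-embedding : WeakEmb IP RP (IA ⊕ J) RA h
  extended-embedding = proj₁ emb , preserves , proj₂ (proj₂ emb)
    where
      preserves : ∀ f as a → graph IP f as a → graph (IA ⊕ J) f (map h as) (h a)
      preserves (inj₁ f) = proj₁ (proj₂ emb) f
      preserves (inj₂ f) = push-extends (restrict IP inj₂) f

  -- On the Π₂-reducts h reflects applications: Σ₀-applications because P is
  -- total on Σ₀ and A's Σ₀-functions are functional, Σ₂-ones by construction.
  reduct-reflects : Total (restrict IP (inj₁ ∘ inj₁)) →
                    ReflectsApplications (red₂ IP) (red₂ (IA ⊕ J)) h
  reduct-reflects total (inj₁ f) ps b gr with total f ps
  ... | p , gp = p , gp , functional IA (proj₁ (proj₂ emb) (inj₁ f) ps p gp) gr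
  reduct-reflects total (inj₂ f) = push-reflects (restrict IP inj₂) f

  reduct-domain : Σ₂-DomainInImage (red₂ (IA ⊕ J)) h
  reduct-domain f bs b (as , e , _) = as , e

  weakSat-extension : ExcludedMiddle 0ℓ → P → Total (restrict IP (inj₁ ∘ inj₁)) →
                      (K2 : Clause [ ar0 , ar2 ] par → Set) →
                      ((C : Clause [ ar0 , ar2 ] par) → K2 C → Σ₂-Flat C × VarsBelow₂ C) →
                      WeakSat (red₂ IP) RP K2 → WeakSat (red₂ (IA ⊕ J)) RA K2
  weakSat-extension em p₀ total K2 shape ws C inK β
    with em {Σ ℕ λ x → OccursC {par = par} x C × ¬ InImage h (β x)}
  ... | yes (x , occ , outside) =
    OutsideImage.weakClause-outside (red₂ (IA ⊕ J)) RA h reduct-domain β outside C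
      (proj₂ (proj₁ (shape C inK))) (proj₂ (shape C inK) x occ)
  ... | no inside =
    Transfer.weakClause-transfer (red₂ IP) RP (red₂ (IA ⊕ J)) RA h
      (red₂-embedding {RP = RP} {RA = RA} extended-embedding) (reduct-reflects total)
      α β C agree (ws C inK α)
    where
      pullback : Σ (ℕ → P) λ α → (x : ℕ) → InImage h (β x) → h (α x) ≡ β x
      pullback = pullback-assignment h em p₀ β
      α : ℕ → P
      α = proj₁ pullback
      agree : (x : ℕ) → OccursC x C → h (α x) ≡ β x
      agree x occ = proj₂ pullback x (decidable-stable em (λ out → inside (x , occ , out)))

-- The corollary: expand A by the push-forward J of the Σ₂-functions of P.
corollary1 : ExcludedMiddle 0ℓ →
    {F0 F1 F2 Pr : Set} (ar0 : F0 → ℕ) (ar1 : F1 → ℕ) (ar2 : F2 → ℕ) (par : Pr → ℕ)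
    (T0 : Formula ar0 par → Set)
    (K2 : Clause [ ar0 , ar2 ] par → Set) →
    ((C : Clause [ ar0 , ar2 ] par) → K2 C → Σ₂-Flat C × VarsBelow₂ C) →
    (P : Set) → P → (IP : PFuns P [ [ ar0 , ar1 ] , ar2 ]) (RP : Rels P par) →
    Total (restrict IP (inj₁ ∘ inj₁)) →
    Model (restrict IP (inj₁ ∘ inj₁)) RP T0 →
    WeakSat (red₂ IP) RP K2 →
    (A : Set) → A → (IA : PFuns A [ ar0 , ar1 ]) (RA : Rels A par) →
    Total IA →
    (h : P → A) →
    WeakEmb (restrict IP inj₁) RP IA RA h →
    Σ (PFuns A ar2) λ J →
    WeakSat (red₂ (IA ⊕ J)) RA K2 × WeakEmb IP RP (IA ⊕ J) RA h
corollary1 em ar0 ar1 ar2 par T0 K2 shape P p₀ IP RP total _ ws A _ IA RA _ h emb =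
  J , weakSat-extension em p₀ total K2 shape ws , extended-embedding
  where open Extension IP RP IA RA h emb
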